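{- Let $m, R, \delta, c \in \mathbb N$. The following two statements are equivalent: (1) There is a coloring with $c$ colors of the set of all chains in $[m]$ of length $2\delta$ and size at most $R$ such that for any two chains $\mathcal A = \langle \alpha, A_1, \ldots, A_{2\delta} \rangle$ and $\mathcal B = \langle \beta, B_1, \ldots, B_{2\delta}\rangle$ in this set with $S^1(\mathcal A) \cap S^1(\mathcal B) \neq \emptyset$ and $\alpha \neq \beta$, $\mathcal A$ and $\mathcal B$ receive different colors. (2) There is a proper $c$-coloring of $U(m,R,\delta)$.
   Context: For $m\in\mathbb N$, a chain of length $f$ and size $s$ in $[m]=\{1,\dots,m\}$ is a nested sequence $A_0\subseteq A_1\subseteq\cdots\subseteq A_f\subseteq[m]$ with $|A_0|=1$ and $|A_f|=s$; it is written $\langle A_0,\dots,A_f\rangle$, or $\langle\alpha,A_1,\dots,A_f\rangle$ where $A_0=\{\alpha\}$. For a chain $\mathcal A=\langle A_0,\dots,A_f\rangle$, $S^1(\mathcal A)$ is the set of all chains $\langle B_0,\dots,B_{f-1}\rangle$ such that $A_{i-1}\subseteq B_i\subseteq A_{i+1}$ for $0\le i\le f-1$, where $A_{ -1}=\emptyset$. The graph $U(m,R,\delta)$ has as vertices all chains in $[m]$ of length $\delta$ and size at most $R$, and $\langle\alpha,A_1,\dots,A_\delta\rangle$, $\langle\beta,B_1,\dots,B_\delta\rangle$ are adjacent iff $\alpha\neq\beta$, $\alpha\in B_1$, $\beta\in A_1$, and $A_i\subseteq B_{i+1}$, $B_i\subseteq A_{i+1}$ for all $1\le i\le\delta-1$.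 -}

module Defs where

open import Data.Nat using (ℕ; zero; suc; _≤_; _*_)
open import Data.Fin using (Fin; zero; suc; inject₁; fromℕ)
open import Data.Fin.Subset using (Subset; _⊆_; _∈_; ∣_∣; ⁅_⁆) renaming (⊥ to ∅)
open import Data.Product using (Σ; _×_)
open import Data.Empty using (⊥)
open import Relation.Binary.PropositionalEquality using (_≡_; _≢_)

-- A chain of length f in [m] = Fin m:  A₀ ⊆ A₁ ⊆ ⋯ ⊆ A_f  with A₀ = {α} a singleton.
-- (written ⟨α, A₁, …, A_f⟩ in the paper; |A₀| = 1 is encoded by A₀ = ⁅ root ⁆.)
record Chain (m f : ℕ) : Set where
  field
    root   : Fin m
    sets   : Fin (suc f) → Subset m
    base   : sets zero ≡ ⁅ root ⁆
    nested : (i : Fin f) → sets (inject₁ i) ⊆ sets (suc i)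
open Chain public

size : ∀ {m f} → Chain m f → ℕ
size {f = f} A = ∣ sets A (fromℕ f) ∣

ChainsUpTo : ℕ → ℕ → ℕ → Set
ChainsUpTo m R f = Σ (Chain m f) (λ A → size A ≤ R)

-- B ∈ S¹(A):  A_{i-1} ⊆ B_i ⊆ A_{i+1} for 0 ≤ i ≤ f-1 (A_{-1} = ∅), B a chain of length f-1.
-- For f = 0 there are no chains of length -1, so S¹(A) is empty.
InS1 : ∀ {m f} → Chain m f → Chain m (Data.Nat.pred f) → Set
InS1 {f = zero} A B = ⊥
InS1 {m} {suc f} A B = (i : Fin (suc f)) → lower i ⊆ sets B i × sets B i ⊆ sets A (suc i)
  where
  lower : Fin (suc f) → Subset m
  lower zero    = ∅
  lower (suc j) = sets A (inject₁ (inject₁ j))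

S1Meet : ∀ {m f} → Chain m f → Chain m f → Set
S1Meet {m} {f} A B = Σ (Chain m (Data.Nat.pred f)) (λ C → InS1 A C × InS1 B C)

-- Adjacency in U(m,R,δ) for chains of length δ.  (Only meaningful for δ ≥ 1;
-- for δ = 0 it is set to ⊥, never used since the theorem assumes δ ≥ 1.)
UAdj : ∀ {m δ} → Chain m δ → Chain m δ → Set
UAdj {δ = zero} A B = ⊥
UAdj {δ = suc e} A B =
  root A ≢ root B
  × root A ∈ sets B (suc zero)
  × root B ∈ sets A (suc zero)
  × ((i : Fin e) → sets A (inject₁ (suc i)) ⊆ sets B (suc (suc i))
                 × sets B (inject₁ (suc i)) ⊆ sets A (suc (suc i)))

ChainColouring : ℕ → ℕ → ℕ → ℕ → Set
ChainColouring m R δ c =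
  Σ (ChainsUpTo m R (2 * δ) → Fin c) λ col →
    (A B : ChainsUpTo m R (2 * δ)) →
      S1Meet (Σ.proj₁ A) (Σ.proj₁ B) → root (Σ.proj₁ A) ≢ root (Σ.proj₁ B) →
      col A ≢ col B

ProperColouringU : ℕ → ℕ → ℕ → ℕ → Set
ProperColouringU m R δ c =
  Σ (ChainsUpTo m R δ → Fin c) λ col →
    (A B : ChainsUpTo m R δ) → UAdj (Σ.proj₁ A) (Σ.proj₁ B) → col A ≢ col B

-- A chain of length 2δ is folded onto one of length δ by keeping its even-indexed sets, and a
-- chain of length δ is unfolded onto one of length 2δ by repeating each set A₁, …, A_δ twice.
-- If C ∈ S¹(A) ∩ S¹(B) then A_{2j} ⊆ C_{2j+1} ⊆ B_{2j+2}, so the folded chains are adjacent in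
-- U(m,R,δ). Conversely, if A and B are adjacent, the chain ⟨α, A₀ ∪ B₀, A₁ ∪ B₁, A₁ ∪ B₁,
-- A₂ ∪ B₂, …⟩ lies in the S¹ of both unfolded chains. Both maps keep the root and the size, so
-- either one pulls a colouring back.
module Submission where

open import Defs
open import Data.Nat using (ℕ; zero; suc; pred; _*_; _≤_; _<_; _≤′_; ≤′-reflexive; ≤′-step; s≤s; z≤n; ⌈_/2⌉)
open import Data.Nat.Properties
  using (≤⇒≤′; <⇒≤; <⇒≤pred; ≮⇒≥; m≤n⇒m≤1+n; m<n⇒m<1+n; n≤1+n; _<?_; *-suc; *-monoʳ-≤; ⌈n/2⌉-mono)
open import Data.Fin using (Fin; zero; suc; toℕ; inject₁; fromℕ; fromℕ<)
open import Data.Fin.Properties using (toℕ-inject₁; toℕ-fromℕ; toℕ-fromℕ<; toℕ<n)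
open import Data.Fin.Subset using (Subset; _⊆_; _∈_; _∪_; ∣_∣; ⁅_⁆)
open import Data.Fin.Subset.Properties using (⊆-reflexive; ⊥⊆; x∈⁅x⁆; x∈⁅y⁆⇒x≡y; p⊆p∪q; q⊆p∪q; x∈p∪q⁻)
open import Data.Product using (_×_; _,_; proj₁; proj₂)
open import Data.Sum using (inj₁; inj₂)
open import Function using (_∘_)
open import Relation.Nullary using (yes; no)
open import Relation.Binary.PropositionalEquality
  using (_≡_; _≢_; refl; sym; trans; cong; subst; subst₂; module ≡-Reasoning)

private
  variable
    m n f g e k : ℕ

∀Fin⇒∀< : {P : ℕ → Set} → ((i : Fin n) → P (toℕ i)) → ∀ k → k < n → P k
∀Fin⇒∀< {P = P} h k k<n = subst P (toℕ-fromℕ< k<n) (h (fromℕ< k<n))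

∪-least : {p q r : Subset m} → p ⊆ r → q ⊆ r → p ∪ q ⊆ r
∪-least {p = p} {q} p⊆r q⊆r x∈p∪q with x∈p∪q⁻ p q x∈p∪q
... | inj₁ x∈p = p⊆r x∈p
... | inj₂ x∈q = q⊆r x∈q

⌈2*n/2⌉≡n : ∀ n → ⌈ 2 * n /2⌉ ≡ n
⌈2*n/2⌉≡n zero    = refl
⌈2*n/2⌉≡n (suc n) = trans (cong ⌈_/2⌉ (*-suc 2 n)) (cong suc (⌈2*n/2⌉≡n n))

2+k≤2*n⇒⌈k/2⌉<n : suc (suc k) ≤ 2 * n → ⌈ k /2⌉ < n
2+k≤2*n⇒⌈k/2⌉<n {k = k} {n = n} le = subst (⌈ suc (suc k) /2⌉ ≤_) (⌈2*n/2⌉≡n n) (⌈n/2⌉-mono le)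

clamp : ℕ → (f : ℕ) → Fin (suc f)
clamp zero    f       = zero
clamp (suc k) zero    = zero
clamp (suc k) (suc f) = suc (clamp k f)

clamp-toℕ : (i : Fin (suc f)) → clamp (toℕ i) f ≡ i
clamp-toℕ         zero    = refl
clamp-toℕ {suc f} (suc i) = cong suc (clamp-toℕ i)

toℕ-clamp : k ≤ f → toℕ (clamp k f) ≡ k
toℕ-clamp z≤n       = refl
toℕ-clamp (s≤s k≤f) = cong suc (toℕ-clamp k≤f)

clamp-≥ : f ≤ k → clamp k f ≡ fromℕ f
clamp-≥ {k = zero}  z≤n       = refl
clamp-≥ {k = suc k} z≤n       = refl
clamp-≥             (s≤s f≤k) = cong suc (clamp-≥ f≤k)

-- The sets of a chain indexed by ℕ, constant A_f from index f on.
infixl 9 _‼_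
_‼_ : Chain m f → ℕ → Subset m
_‼_ {f = f} A k = sets A (clamp k f)

‼-index : (A : Chain m f) {i : Fin (suc f)} → toℕ i ≡ k → A ‼ k ≡ sets A i
‼-index A {i} refl = cong (sets A) (clamp-toℕ i)

‼-≥ : (A : Chain m f) → f ≤ k → A ‼ k ≡ sets A (fromℕ f)
‼-≥ A f≤k = cong (sets A) (clamp-≥ f≤k)

‼-suc : (A : Chain m f) (k : ℕ) → A ‼ k ⊆ A ‼ suc k
‼-suc {f = f} A k with k <? f
... | yes k<f = subst₂ _⊆_
  (sym (‼-index A (trans (toℕ-inject₁ (fromℕ< k<f)) (toℕ-fromℕ< k<f))))
  (sym (‼-index A (cong suc (toℕ-fromℕ< k<f))))
  (nested A (fromℕ< k<f))
... | no k≮f = ⊆-reflexive (trans (‼-≥ A (≮⇒≥ k≮f)) (sym (‼-≥ A (m≤n⇒m≤1+n (≮⇒≥ k≮f)))))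

‼-mono : (A : Chain m f) {j k : ℕ} → j ≤ k → A ‼ j ⊆ A ‼ k
‼-mono A = go ∘ ≤⇒≤′
  where
  go : ∀ {j k} → j ≤′ k → A ‼ j ⊆ A ‼ k
  go (≤′-reflexive refl) = ⊆-reflexive refl
  go (≤′-step j≤′k)      = ‼-suc A _ ∘ go j≤′k

root∈‼0 : (A : Chain m f) → root A ∈ A ‼ 0
root∈‼0 A = subst (root A ∈_) (sym (base A)) (x∈⁅x⁆ (root A))

∈‼0⇒≡root : (A : Chain m f) {x : Fin m} → x ∈ A ‼ 0 → x ≡ root A
∈‼0⇒≡root A {x} x∈A₀ = x∈⁅y⁆⇒x≡y (root A) (subst (x ∈_) (base A) x∈A₀)

fromFamily : (α : Fin m) (s : ℕ → Subset m) → s 0 ≡ ⁅ α ⁆ → (∀ k → s k ⊆ s (suc k)) → Chain m f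
fromFamily α s s₀ s-step = record
  { root   = α
  ; sets   = s ∘ toℕ
  ; base   = s₀
  ; nested = λ i → subst (_⊆ s (suc (toℕ i))) (cong s (sym (toℕ-inject₁ i))) (s-step (toℕ i))
  }

module Reindex (h : ℕ → ℕ) (h-zero : h 0 ≡ 0) (h-step : ∀ k → h k ≤ h (suc k)) where

  reindex : Chain m f → Chain m g
  reindex A = fromFamily (root A) (λ k → A ‼ h k) (trans (cong (A ‼_) h-zero) (base A))
                         (λ k → ‼-mono A (h-step k))

  ‼-reindex : (A : Chain m f) → k ≤ g → reindex {g = g} A ‼ k ≡ A ‼ h k
  ‼-reindex A k≤g = cong (λ k → A ‼ h k) (toℕ-clamp k≤g)

  size-reindex : (A : Chain m f) → h g ≡ f → size (reindex {g = g} A) ≡ size A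
  size-reindex {f = f} {g = g} A hg≡f = cong ∣_∣ (begin
    A ‼ h (toℕ (fromℕ g))  ≡⟨ cong (λ k → A ‼ h k) (toℕ-fromℕ g) ⟩
    A ‼ h g                ≡⟨ cong (A ‼_) hg≡f ⟩
    A ‼ f                  ≡⟨ ‼-index A (toℕ-fromℕ f) ⟩
    sets A (fromℕ f)       ∎)
    where open ≡-Reasoning

  reindexUpTo : {R : ℕ} → h g ≡ f → ChainsUpTo m R f → ChainsUpTo m R g
  reindexUpTo {R = R} hg≡f (A , size≤R) = reindex A , subst (_≤ R) (sym (size-reindex A hg≡f)) size≤R

open Reindex (2 *_) refl (λ k → *-monoʳ-≤ 2 (n≤1+n k))
  renaming (reindex to evens; ‼-reindex to ‼-evens; reindexUpTo to evensUpTo)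
open Reindex ⌈_/2⌉ refl (λ k → ⌈n/2⌉-mono (n≤1+n k))
  renaming (reindex to stutter; ‼-reindex to ‼-stutter; reindexUpTo to stutterUpTo)

_↝⟨_⟩_ : Chain m f → ℕ → Chain m g → Set
A ↝⟨ n ⟩ B = ∀ j → j < n → A ‼ j ⊆ B ‼ suc j

↝-refl : (A : Chain m f) → A ↝⟨ n ⟩ A
↝-refl A j _ = ‼-suc A j

InS1⇒↝ : (D : Chain m (suc f)) (C : Chain m f) → InS1 D C → C ↝⟨ suc f ⟩ D × D ↝⟨ f ⟩ C
InS1⇒↝ D C D∋C =
  ∀Fin⇒∀< (λ i → subst₂ _⊆_ (sym (‼-index C refl)) (sym (‼-index D refl)) (proj₂ (D∋C i))) ,
  ∀Fin⇒∀< (λ j → subst₂ _⊆_ (sym (‼-index D (trans (toℕ-inject₁ _) (toℕ-inject₁ j))))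
                             (sym (‼-index C refl))
                             (proj₁ (D∋C (suc j))))

↝⇒InS1 : (D : Chain m (suc f)) (C : Chain m f) → C ↝⟨ suc f ⟩ D → D ↝⟨ f ⟩ C → InS1 D C
↝⇒InS1 D C C↝D D↝C zero    = ⊥⊆ , C↝D 0 (s≤s z≤n)
↝⇒InS1 D C C↝D D↝C (suc j) =
  subst₂ _⊆_ (‼-index D (trans (toℕ-inject₁ _) (toℕ-inject₁ j))) (‼-index C refl) (D↝C (toℕ j) (toℕ<n j)) ,
  subst₂ _⊆_ (‼-index C refl) (‼-index D refl) (C↝D (suc (toℕ j)) (toℕ<n (suc j)))

UAdj⇒↝ : (A B : Chain m (suc e)) → UAdj A B → A ↝⟨ suc e ⟩ B × B ↝⟨ suc e ⟩ A
UAdj⇒↝ A B (_ , rootA∈B₁ , rootB∈A₁ , steps) =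
  step-↝ A B rootA∈B₁ (proj₁ ∘ steps) , step-↝ B A rootB∈A₁ (proj₂ ∘ steps)
  where
  step-↝ : (X Y : Chain m (suc e)) → root X ∈ sets Y (suc zero) →
           ((i : Fin e) → sets X (inject₁ (suc i)) ⊆ sets Y (suc (suc i))) → X ↝⟨ suc e ⟩ Y
  step-↝ X Y rootX∈Y₁ _ zero _ x∈X₀ = subst (_∈ Y ‼ 1) (sym (∈‼0⇒≡root X x∈X₀)) rootX∈Y₁
  step-↝ X Y _ X⊆Y (suc j) (s≤s j<e) = ∀Fin⇒∀< {P = λ j → X ‼ suc j ⊆ Y ‼ suc (suc j)} (λ i →
    subst₂ _⊆_ (sym (‼-index X (toℕ-inject₁ (suc i)))) (sym (‼-index Y refl)) (X⊆Y i)) j j<e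

↝⇒UAdj : (A B : Chain m (suc e)) → root A ≢ root B → A ↝⟨ suc e ⟩ B → B ↝⟨ suc e ⟩ A → UAdj A B
↝⇒UAdj A B rootA≢rootB A↝B B↝A =
  rootA≢rootB , A↝B 0 (s≤s z≤n) (root∈‼0 A) , B↝A 0 (s≤s z≤n) (root∈‼0 B) ,
  λ i → step A B A↝B i , step B A B↝A i
  where
  step : (X Y : Chain m (suc e)) → X ↝⟨ suc e ⟩ Y → (i : Fin e) →
         sets X (inject₁ (suc i)) ⊆ sets Y (suc (suc i))
  step X Y X↝Y i = subst₂ _⊆_ (‼-index X (toℕ-inject₁ (suc i))) (‼-index Y refl)
                              (X↝Y (suc (toℕ i)) (s≤s (toℕ<n i)))

evens-↝ : (A B : Chain m (2 * suc e)) (C : Chain m (pred (2 * suc e))) →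
          InS1 A C → InS1 B C → evens A ↝⟨ suc e ⟩ evens {g = suc e} B
evens-↝ {e = e} A B C A∋C B∋C j j<δ =
  subst₂ _⊆_ (sym (‼-evens A (<⇒≤ j<δ))) (sym (trans (‼-evens B j<δ) (cong (B ‼_) (*-suc 2 j))))
    (C↝B (suc (2 * j)) 2+2j≤2δ ∘ A↝C (2 * j) (<⇒≤pred 2+2j≤2δ))
  where
  2+2j≤2δ : suc (suc (2 * j)) ≤ 2 * suc e
  2+2j≤2δ = subst (_≤ 2 * suc e) (*-suc 2 j) (*-monoʳ-≤ 2 j<δ)
  A↝C : A ↝⟨ pred (2 * suc e) ⟩ C
  A↝C = proj₂ (InS1⇒↝ A C A∋C)
  C↝B : C ↝⟨ 2 * suc e ⟩ B
  C↝B = proj₁ (InS1⇒↝ B C B∋C)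

evens-UAdj : (A B : Chain m (2 * suc e)) → S1Meet A B → root A ≢ root B →
             UAdj (evens A) (evens {g = suc e} B)
evens-UAdj A B (C , A∋C , B∋C) rootA≢rootB =
  ↝⇒UAdj (evens A) (evens B) rootA≢rootB (evens-↝ A B C A∋C B∋C) (evens-↝ B A C B∋C A∋C)

mergeFamily : (A B : Chain m n) → ℕ → Subset m
mergeFamily A B zero    = A ‼ 0
mergeFamily A B (suc k) = A ‼ ⌈ k /2⌉ ∪ B ‼ ⌈ k /2⌉

mergeFamily-step : (A B : Chain m n) → ∀ k → mergeFamily A B k ⊆ mergeFamily A B (suc k)
mergeFamily-step A B zero    = p⊆p∪q (B ‼ 0)
mergeFamily-step A B (suc k) =
  ∪-least (p⊆p∪q (B ‼ _) ∘ ‼-mono A ⌈k/2⌉≤⌈1+k/2⌉) (q⊆p∪q (A ‼ _) (B ‼ _) ∘ ‼-mono B ⌈k/2⌉≤⌈1+k/2⌉)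
  where
  ⌈k/2⌉≤⌈1+k/2⌉ : ⌈ k /2⌉ ≤ ⌈ suc k /2⌉
  ⌈k/2⌉≤⌈1+k/2⌉ = ⌈n/2⌉-mono (n≤1+n k)

merge : (A B : Chain m n) → Chain m f
merge A B = fromFamily (root A) (mergeFamily A B) (base A) (mergeFamily-step A B)

‼-merge : (A B : Chain m n) → k ≤ f → merge {f = f} A B ‼ k ≡ mergeFamily A B k
‼-merge A B k≤f = cong (mergeFamily A B) (toℕ-clamp k≤f)

merge-InS1 : (A B X : Chain m (suc e)) → A ↝⟨ suc e ⟩ X → B ↝⟨ suc e ⟩ X →
             (∀ j → X ‼ j ⊆ A ‼ j ∪ B ‼ j) →
             InS1 (stutter {g = 2 * suc e} X) (merge A B)
merge-InS1 {e = e} A B X A↝X B↝X X⊆A∪B = ↝⇒InS1 (stutter X) (merge A B) merge↝stutter stutter↝merge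
  where
  merge↝stutter : merge {f = pred (2 * suc e)} A B ↝⟨ 2 * suc e ⟩ stutter X
  merge↝stutter zero    1≤2δ = subst (A ‼ 0 ⊆_) (sym (‼-stutter X 1≤2δ)) (A↝X 0 (s≤s z≤n))
  merge↝stutter (suc k) 2+k≤2δ =
    subst₂ _⊆_ (sym (‼-merge A B (<⇒≤pred 2+k≤2δ))) (sym (‼-stutter X 2+k≤2δ))
      (∪-least (A↝X ⌈ k /2⌉ ⌈k/2⌉<δ) (B↝X ⌈ k /2⌉ ⌈k/2⌉<δ))
    where
    ⌈k/2⌉<δ : ⌈ k /2⌉ < suc e
    ⌈k/2⌉<δ = 2+k≤2*n⇒⌈k/2⌉<n 2+k≤2δ
  stutter↝merge : stutter X ↝⟨ pred (2 * suc e) ⟩ merge {f = pred (2 * suc e)} A B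
  stutter↝merge k k<f =
    subst₂ _⊆_ (sym (‼-stutter X (<⇒≤ (m<n⇒m<1+n k<f)))) (sym (‼-merge A B k<f))
      (X⊆A∪B ⌈ k /2⌉)

stutter-S1Meet : (A B : Chain m (suc e)) → UAdj A B → S1Meet (stutter {g = 2 * suc e} A) (stutter B)
stutter-S1Meet {e = e} A B adj =
  merge {f = pred (2 * suc e)} A B ,
  merge-InS1 A B A (↝-refl A) B↝A (λ j → p⊆p∪q (B ‼ j)) ,
  merge-InS1 A B B A↝B (↝-refl B) (λ j → q⊆p∪q (A ‼ j) (B ‼ j))
  where
  A↝B : A ↝⟨ suc e ⟩ B
  A↝B = proj₁ (UAdj⇒↝ A B adj)
  B↝A : B ↝⟨ suc e ⟩ A
  B↝A = proj₂ (UAdj⇒↝ A B adj)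

proposition2p8 : (m R δ c : ℕ) → 1 ≤ δ →
    ((ChainColouring m R δ c → ProperColouringU m R δ c)
    × (ProperColouringU m R δ c → ChainColouring m R δ c))
proposition2p8 m R (suc e) c _ = colouring⇒proper , proper⇒colouring
  where
  unfold : ChainsUpTo m R (suc e) → ChainsUpTo m R (2 * suc e)
  unfold = stutterUpTo (⌈2*n/2⌉≡n (suc e))
  fold : ChainsUpTo m R (2 * suc e) → ChainsUpTo m R (suc e)
  fold = evensUpTo refl
  colouring⇒proper : ChainColouring m R (suc e) c → ProperColouringU m R (suc e) c
  colouring⇒proper (colour , separates) = colour ∘ unfold , λ A B adj →
    separates (unfold A) (unfold B) (stutter-S1Meet (proj₁ A) (proj₁ B) adj) (proj₁ adj)
  proper⇒colouring : ProperColouringU m R (suc e) c → ChainColouring m R (suc e) c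
  proper⇒colouring (colour , proper) = colour ∘ fold , λ A B meet rootA≢rootB →
    proper (fold A) (fold B) (evens-UAdj (proj₁ A) (proj₁ B) meet rootA≢rootB)
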